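{- Let $A$ be a finite set of atoms and $P,Q,R$ propositional Horn theories over $A$. If $P$ does not depend on $R$, i.e. $body(P)\cap head(R)=\emptyset$, then $$P\circ(Q\cup R)=P\circ Q.$$
   Context: A theory over $A$ is a finite set of rules $a_0\leftarrow a_1,\ldots,a_k$ ($k\ge0$, $a_i\in A$), with $head(r)=\{a_0\}$, $body(r)=\{a_1,\ldots,a_k\}$, size $k$; $head(S)=\bigcup_{s\in S}head(s)$, $body(S)=\bigcup_{s\in S}body(s)$. Write $S\subseteq_r R$ if $S\subseteq R$ has as many elements as the size of $r$. Composition: $P\circ R=\{head(r)\leftarrow body(S)\mid r\in P,\ S\subseteq_r R,\ head(S)=body(r)\}$. -}

module Defs where

open import Data.Nat using (ℕ)
open import Data.Fin using (Fin)
open import Data.Fin.Subset using (Subset; ⋃; ⁅_⁆; ∣_∣)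
open import Data.List using (List; map; length)
open import Data.List.Membership.Propositional using (_∈_)
open import Data.List.Relation.Unary.All using (All)
open import Data.List.Relation.Unary.Unique.Propositional using (Unique)
open import Data.Product using (Σ; _×_; ∃-syntax)
open import Relation.Binary.PropositionalEquality using (_≡_)

record Rule (n : ℕ) : Set where
  constructor _←_
  field
    hd : Fin n
    bd : Subset n
open Rule public

-- A theory is a finite set of rules, represented by a list (read as a set).
Theory : ℕ → Set
Theory n = List (Rule n)

head : ∀ {n} → Rule n → Subset n
head r = ⁅ hd r ⁆

body : ∀ {n} → Rule n → Subset n
body r = bd r

size : ∀ {n} → Rule n → ℕ
size r = ∣ body r ∣

headT : ∀ {n} → Theory n → Subset n
headT S = ⋃ (map head S)

bodyT : ∀ {n} → Theory n → Subset n
bodyT S = ⋃ (map body S)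

_⊆[_]_ : ∀ {n} → Theory n → Rule n → Theory n → Set
S ⊆[ r ] R = Unique S × All (_∈ R) S × length S ≡ size r

_∈∘_ : ∀ {n} → Rule n → Theory n × Theory n → Set
_∈∘_ {n} x (P Data.Product., R) =
  ∃[ r ] ∃[ S ] (r ∈ P × S ⊆[ r ] R × headT S ≡ body r
                 × x ≡ (hd r ← bodyT S))

-- Composition only uses sets S of rules whose heads are the body of a rule of P.
-- If P's bodies avoid the heads of R, no rule of such an S comes from R, so S
-- already lies in Q; the converse inclusion is monotonicity in the right argument.

module Submission where

open import Defs
open import Data.Nat using (ℕ)
open import Data.Fin using (Fin)
open import Data.Fin.Subset using (Subset; ⋃; _∩_; ⊥) renaming (_∈_ to _∈ₛ_)
open import Data.Fin.Subset.Properties using (x∈p∪q⁺; x∈p∩q⁺; ∉⊥; x∈⁅x⁆)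
open import Data.List using (List; _++_)
open import Data.List.Relation.Unary.Any using (here; there)
open import Data.List.Membership.Propositional using (_∈_)
open import Data.List.Membership.Propositional.Properties using (∈-map⁺; ∈-++⁻)
open import Data.List.Relation.Unary.All using (tabulate; lookup)
open import Data.List.Relation.Binary.Subset.Propositional using (_⊆_)
open import Data.List.Relation.Binary.Subset.Propositional.Properties using (xs⊆xs++ys)
open import Data.Product using (_,_)
open import Data.Sum using (inj₁; inj₂)
open import Data.Empty using (⊥-elim)
open import Function.Bundles using (_⇔_; mk⇔)
open import Relation.Binary.PropositionalEquality using (_≡_; refl; subst)
open import Relation.Nullary using (¬_)

∈-⋃⁺ : ∀ {n} {x : Fin n} {p : Subset n} {ps : List (Subset n)} →
       p ∈ ps → x ∈ₛ p → x ∈ₛ ⋃ ps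
∈-⋃⁺ (here refl) x∈p = x∈p∪q⁺ (inj₁ x∈p)
∈-⋃⁺ (there p∈ps) x∈p = x∈p∪q⁺ (inj₂ (∈-⋃⁺ p∈ps x∈p))

hd∈headT : ∀ {n} {s : Rule n} {S : Theory n} → s ∈ S → hd s ∈ₛ headT S
hd∈headT {s = s} s∈S = ∈-⋃⁺ (∈-map⁺ head s∈S) (x∈⁅x⁆ (hd s))

body⊆bodyT : ∀ {n} {x : Fin n} {r : Rule n} {P : Theory n} →
             r ∈ P → x ∈ₛ body r → x ∈ₛ bodyT P
body⊆bodyT r∈P = ∈-⋃⁺ (∈-map⁺ body r∈P)

⊆[]-restrict : ∀ {n} {r : Rule n} {S R R′ : Theory n} →
               (∀ {s} → s ∈ S → s ∈ R → s ∈ R′) → S ⊆[ r ] R → S ⊆[ r ] R′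
⊆[]-restrict R→R′ (unique , S⊆R , length≡size) =
  unique , tabulate (λ s∈S → R→R′ s∈S (lookup S⊆R s∈S)) , length≡size

∈∘-monoʳ : ∀ {n} {P R R′ : Theory n} → R ⊆ R′ →
           ∀ {x : Rule n} → x ∈∘ (P , R) → x ∈∘ (P , R′)
∈∘-monoʳ R⊆R′ (r , S , r∈P , S⊆R , headS≡body , x≡) =
  r , S , r∈P , ⊆[]-restrict {r = r} (λ _ → R⊆R′) S⊆R , headS≡body , x≡

∉-disjoint : ∀ {n} {p q : Subset n} {x : Fin n} → p ∩ q ≡ ⊥ → x ∈ₛ p → ¬ x ∈ₛ q
∉-disjoint p∩q≡⊥ x∈p x∈q = ∉⊥ (subst (_ ∈ₛ_) p∩q≡⊥ (x∈p∩q⁺ (x∈p , x∈q)))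

hd∈bodyT : ∀ {n} {P S : Theory n} {r s : Rule n} →
           r ∈ P → headT S ≡ body r → s ∈ S → hd s ∈ₛ bodyT P
hd∈bodyT r∈P headS≡body s∈S = body⊆bodyT r∈P (subst (_ ∈ₛ_) headS≡body (hd∈headT s∈S))

∈∘-++-independent : ∀ {n} {P Q R : Theory n} → bodyT P ∩ headT R ≡ ⊥ →
                    ∀ {x : Rule n} → x ∈∘ (P , Q ++ R) → x ∈∘ (P , Q)
∈∘-++-independent {Q = Q} independent (r , S , r∈P , S⊆Q++R , headS≡body , x≡) =
  r , S , r∈P , ⊆[]-restrict {r = r} inQ S⊆Q++R , headS≡body , x≡
  where
  inQ : ∀ {s} → s ∈ S → s ∈ Q ++ _ → s ∈ Q
  inQ s∈S s∈Q++R with ∈-++⁻ Q s∈Q++R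
  ... | inj₁ s∈Q = s∈Q
  ... | inj₂ s∈R = ⊥-elim (∉-disjoint independent (hd∈bodyT r∈P headS≡body s∈S) (hd∈headT s∈R))

lemma5p2 : ∀ {n : ℕ} (P Q R : Theory n) → bodyT P ∩ headT R ≡ ⊥
    → ∀ (x : Rule n) → (x ∈∘ (P , Q ++ R)) ⇔ (x ∈∘ (P , Q))
lemma5p2 P Q R independent x =
  mk⇔ (∈∘-++-independent independent) (∈∘-monoʳ (xs⊆xs++ys Q R))
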